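{- Suppose that, in the interpretation functor $[\![-]\!]$ described below, the clause for disjunction is replaced by: $[\![\phi \vee \psi]\!]$ is the coproduct $[\![\phi]\!] + [\![\psi]\!]$ in the presheaf category $[\mathcal{W}^{op},\mathbf{Set}]$, given pointwise by disjoint union. Then, for atoms $p,q,r$, there is a natural transformation from $[\![p \supset (q \vee r)]\!]$ to $[\![(p \supset q) \vee (p \supset r)]\!]$.
   Context: A base $\mathcal{B}$ is a countable set of atomic rules $((P_1 \Rightarrow q_1),\ldots,(P_n \Rightarrow q_n)) \Rightarrow r$, where the $P_i$ are sets of atoms and $q_i, r$ are atoms. Derivations of an atom from a context $(X\!:\!P)$ of atoms in a base are generated by two rules. (Ref) gives $(X\!:\!P), x\!:\!p \vdash_{\mathcal{B}} x\!:\!p$. (App) states: if $(X\!:\!P),(X_i\!:\!P_i) \vdash_{\mathcal{B}} \Phi_i\!:\!q_i$ for each $i$, then $(X\!:\!P)\vdash_{\mathcal{B}} \Phi_{\mathcal{R}}(\Phi_1,\ldots,\Phi_n)\!:\!r$, for a rule $\mathcal{R}$ of $\mathcal{B}$. $\mathcal{W}$ is the category whose objects are pairs $(\mathcal{B},(X\!:\!P))$ of a base and a context. A morphism $(\mathcal{B},(X\!:\!P)) \to (\mathcal{C},(Y\!:\!Q))$ consists of an inclusion $\mathcal{C}\subseteq\mathcal{B}$ together with derivations $X\!:\!P \vdash_{\mathcal{B}} \Phi_i\!:\!q_i$ for each $q_i \in Q$. Composition is substitution. Formulae are interpreted as presheaves $[\![\phi]\!]:\mathcal{W}^{op}\to\mathbf{Set}$.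 - For an atom $p$, $[\![p]\!](\mathcal{B},(X\!:\!P))$ is the set of derivations $(X\!:\!P)\vdash_{\mathcal{B}}\Phi\!:\!p$, with action on morphisms given by substitution. - Conjunction is interpreted as the product of presheaves. - Implication is interpreted as the exponential of presheaves: $(F\supset G)(w)=\mathrm{Nat}(\hom(-,w)\times F, G)$. In the original interpretation, $[\![\phi\vee\psi]\!]$ is $\forall_{\mathcal{A}}$ (the product over all atoms $p$) of $([\![\phi]\!]\supset[\![p]\!])\supset(([\![\psi]\!]\supset[\![p]\!])\supset[\![p]\!])$. The theorem considers replacing this with the coproduct. -}

module Defs where

open import Data.Nat using (ℕ)
open import Data.Maybe using (Maybe; just)
open import Data.List using (List; []; _∷_; _++_)
open import Data.Product using (Σ; _×_; _,_; proj₁; proj₂)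
open import Data.Sum using (_⊎_; inj₁; inj₂)
open import Data.Empty using (⊥)
open import Relation.Binary.PropositionalEquality
  using (_≡_; refl; sym; trans; cong; cong₂; subst)

Atom : Set
Atom = ℕ

-- A context (X : P) is a list of atoms; variables are de Bruijn
-- positions in it (so distinct variables may carry the same atom).
Ctx : Set
Ctx = List Atom

record Rule : Set where
  constructor _⇒_
  field
    prems : List (Ctx × Atom)
    concl : Atom
open Rule public

-- A base is a countable set of atomic rules, given as an enumeration
-- (nothing enumerates the empty set / finitely many rules).
Base : Set
Base = ℕ → Maybe Rule

_∈B_ : Rule → Base → Set
R ∈B B = Σ ℕ (λ n → B n ≡ just R)

_⊆B_ : Base → Base → Set
C ⊆B B = ∀ {R} → R ∈B C → R ∈B B

data Var : Ctx → Atom → Set where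
  here  : ∀ {Γ p} → Var (p ∷ Γ) p
  there : ∀ {Γ p q} → Var Γ p → Var (q ∷ Γ) p

mutual
  -- (X : P) ⊢_B Φ : p.  (Ref) is 'ref', (App) is 'app'.
  -- The membership proof of the rule is irrelevant: a derivation only
  -- records which rule was applied.
  data Deriv (B : Base) : Ctx → Atom → Set where
    ref : ∀ {Γ p} → Var Γ p → Deriv B Γ p
    app : ∀ {Γ} (R : Rule) → .(R ∈B B) → Args B Γ (prems R) →
          Deriv B Γ (concl R)

  data Args (B : Base) (Γ : Ctx) : List (Ctx × Atom) → Set where
    []  : Args B Γ []
    _∷_ : ∀ {P q ps} → Deriv B (P ++ Γ) q → Args B Γ ps →
          Args B Γ ((P , q) ∷ ps)

Ren : Ctx → Ctx → Set
Ren Γ Δ = ∀ {p} → Var Γ p → Var Δ p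

Sub : Base → Ctx → Ctx → Set
Sub B Γ Δ = ∀ {p} → Var Γ p → Deriv B Δ p

liftR : ∀ {Γ Δ} (P : Ctx) → Ren Γ Δ → Ren (P ++ Γ) (P ++ Δ)
liftR []      ρ x         = ρ x
liftR (a ∷ P) ρ here      = here
liftR (a ∷ P) ρ (there x) = there (liftR P ρ x)

mutual
  ren : ∀ {B Γ Δ p} → Ren Γ Δ → Deriv B Γ p → Deriv B Δ p
  ren ρ (ref x)      = ref (ρ x)
  ren ρ (app R m as) = app R m (renA ρ as)

  renA : ∀ {B Γ Δ ps} → Ren Γ Δ → Args B Γ ps → Args B Δ ps
  renA ρ []                = []
  renA ρ (_∷_ {P} d ds)    = ren (liftR P ρ) d ∷ renA ρ ds

liftS : ∀ {B Γ Δ} (P : Ctx) → Sub B Γ Δ → Sub B (P ++ Γ) (P ++ Δ)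
liftS []      σ x         = σ x
liftS (a ∷ P) σ here      = ref here
liftS (a ∷ P) σ (there x) = ren there (liftS P σ x)

mutual
  sub : ∀ {C B Γ Δ p} → .(C ⊆B B) → Sub B Γ Δ → Deriv C Γ p → Deriv B Δ p
  sub i σ (ref x)      = σ x
  sub i σ (app R m as) = app R (i m) (subA i σ as)

  subA : ∀ {C B Γ Δ ps} → .(C ⊆B B) → Sub B Γ Δ → Args C Γ ps → Args B Δ ps
  subA i σ []             = []
  subA i σ (_∷_ {P} d ds) = sub i (liftS P σ) d ∷ subA i σ ds

private
  _≗R_ : ∀ {Γ Δ} → Ren Γ Δ → Ren Γ Δ → Set
  ρ ≗R ρ' = ∀ {p} (x : Var _ p) → ρ x ≡ ρ' x

  _≗S_ : ∀ {B Γ Δ} → Sub B Γ Δ → Sub B Γ Δ → Set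
  σ ≗S σ' = ∀ {p} (x : Var _ p) → σ x ≡ σ' x

  liftR-cong : ∀ {Γ Δ} P {ρ ρ' : Ren Γ Δ} → ρ ≗R ρ' → liftR P ρ ≗R liftR P ρ'
  liftR-cong []      e x         = e x
  liftR-cong (a ∷ P) e here      = refl
  liftR-cong (a ∷ P) e (there x) = cong there (liftR-cong P e x)

  mutual
    ren-cong : ∀ {B Γ Δ p} {ρ ρ' : Ren Γ Δ} → ρ ≗R ρ' → (d : Deriv B Γ p) →
               ren ρ d ≡ ren ρ' d
    ren-cong e (ref x)      = cong ref (e x)
    ren-cong e (app R m as) = cong (app R m) (renA-cong e as)

    renA-cong : ∀ {B Γ Δ ps} {ρ ρ' : Ren Γ Δ} → ρ ≗R ρ' → (as : Args B Γ ps) →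
                renA ρ as ≡ renA ρ' as
    renA-cong e []             = refl
    renA-cong e (_∷_ {P} d ds) =
      cong₂ _∷_ (ren-cong (liftR-cong P e) d) (renA-cong e ds)

  liftS-cong : ∀ {B Γ Δ} P {σ σ' : Sub B Γ Δ} → σ ≗S σ' → liftS P σ ≗S liftS P σ'
  liftS-cong []      e x         = e x
  liftS-cong (a ∷ P) e here      = refl
  liftS-cong (a ∷ P) e (there x) = cong (ren there) (liftS-cong P e x)

  mutual
    sub-cong : ∀ {C B Γ Δ p} .(i : C ⊆B B) {σ σ' : Sub B Γ Δ} → σ ≗S σ' →
               (d : Deriv C Γ p) → sub i σ d ≡ sub i σ' d
    sub-cong i e (ref x)      = e x
    sub-cong i e (app R m as) = cong (app R (i m)) (subA-cong i e as)

    subA-cong : ∀ {C B Γ Δ ps} .(i : C ⊆B B) {σ σ' : Sub B Γ Δ} → σ ≗S σ' →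
                (as : Args C Γ ps) → subA i σ as ≡ subA i σ' as
    subA-cong i e []             = refl
    subA-cong i e (_∷_ {P} d ds) =
      cong₂ _∷_ (sub-cong i (liftS-cong P e) d) (subA-cong i e ds)

  liftR-comp : ∀ {Γ Δ E} P (ρ₁ : Ren Γ Δ) (ρ₂ : Ren Δ E) →
               (λ {p} (x : Var (P ++ Γ) p) → liftR P ρ₂ (liftR P ρ₁ x))
                 ≗R liftR P (λ x → ρ₂ (ρ₁ x))
  liftR-comp []      ρ₁ ρ₂ x         = refl
  liftR-comp (a ∷ P) ρ₁ ρ₂ here      = refl
  liftR-comp (a ∷ P) ρ₁ ρ₂ (there x) = cong there (liftR-comp P ρ₁ ρ₂ x)

  mutual
    ren-ren : ∀ {B Γ Δ E p} (ρ₁ : Ren Γ Δ) (ρ₂ : Ren Δ E) (d : Deriv B Γ p) →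
              ren ρ₂ (ren ρ₁ d) ≡ ren (λ x → ρ₂ (ρ₁ x)) d
    ren-ren ρ₁ ρ₂ (ref x)      = refl
    ren-ren ρ₁ ρ₂ (app R m as) = cong (app R m) (renA-ren ρ₁ ρ₂ as)

    renA-ren : ∀ {B Γ Δ E ps} (ρ₁ : Ren Γ Δ) (ρ₂ : Ren Δ E) (as : Args B Γ ps) →
               renA ρ₂ (renA ρ₁ as) ≡ renA (λ x → ρ₂ (ρ₁ x)) as
    renA-ren ρ₁ ρ₂ []             = refl
    renA-ren ρ₁ ρ₂ (_∷_ {P} d ds) =
      cong₂ _∷_ (trans (ren-ren (liftR P ρ₁) (liftR P ρ₂) d)
                       (ren-cong (liftR-comp P ρ₁ ρ₂) d))
                (renA-ren ρ₁ ρ₂ ds)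

  liftSR : ∀ {B Γ Δ E} P (ρ : Ren Γ Δ) (σ : Sub B Δ E) →
           (λ {p} (x : Var (P ++ Γ) p) → liftS P σ (liftR P ρ x))
             ≗S liftS P (λ x → σ (ρ x))
  liftSR []      ρ σ x         = refl
  liftSR (a ∷ P) ρ σ here      = refl
  liftSR (a ∷ P) ρ σ (there x) = cong (ren there) (liftSR P ρ σ x)

  mutual
    sub-ren : ∀ {C B Γ Δ E p} .(i : C ⊆B B) (ρ : Ren Γ Δ) (σ : Sub B Δ E)
              (d : Deriv C Γ p) → sub i σ (ren ρ d) ≡ sub i (λ x → σ (ρ x)) d
    sub-ren i ρ σ (ref x)      = refl
    sub-ren i ρ σ (app R m as) = cong (app R (i m)) (subA-ren i ρ σ as)

    subA-ren : ∀ {C B Γ Δ E ps} .(i : C ⊆B B) (ρ : Ren Γ Δ) (σ : Sub B Δ E)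
               (as : Args C Γ ps) → subA i σ (renA ρ as) ≡ subA i (λ x → σ (ρ x)) as
    subA-ren i ρ σ []             = refl
    subA-ren i ρ σ (_∷_ {P} d ds) =
      cong₂ _∷_ (trans (sub-ren i (liftR P ρ) (liftS P σ) d)
                       (sub-cong i (liftSR P ρ σ) d))
                (subA-ren i ρ σ ds)

  liftRS : ∀ {B Γ Δ E} P (σ : Sub B Γ Δ) (ρ : Ren Δ E) →
           (λ {p} (x : Var (P ++ Γ) p) → ren (liftR P ρ) (liftS P σ x))
             ≗S liftS P (λ x → ren ρ (σ x))
  liftRS []      σ ρ x         = refl
  liftRS (a ∷ P) σ ρ here      = refl
  liftRS (a ∷ P) σ ρ (there x) =
    trans (ren-ren there (liftR (a ∷ P) ρ) (liftS P σ x))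
   (trans (sym (ren-ren (liftR P ρ) there (liftS P σ x)))
          (cong (ren there) (liftRS P σ ρ x)))

  mutual
    ren-sub : ∀ {C B Γ Δ E p} .(i : C ⊆B B) (σ : Sub B Γ Δ) (ρ : Ren Δ E)
              (d : Deriv C Γ p) → ren ρ (sub i σ d) ≡ sub i (λ x → ren ρ (σ x)) d
    ren-sub i σ ρ (ref x)      = refl
    ren-sub i σ ρ (app R m as) = cong (app R (i m)) (renA-sub i σ ρ as)

    renA-sub : ∀ {C B Γ Δ E ps} .(i : C ⊆B B) (σ : Sub B Γ Δ) (ρ : Ren Δ E)
               (as : Args C Γ ps) → renA ρ (subA i σ as) ≡ subA i (λ x → ren ρ (σ x)) as
    renA-sub i σ ρ []             = refl
    renA-sub i σ ρ (_∷_ {P} d ds) =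
      cong₂ _∷_ (trans (ren-sub i (liftS P σ) (liftR P ρ) d)
                       (sub-cong i (liftRS P σ ρ) d))
                (renA-sub i σ ρ ds)

  liftSS : ∀ {A B Γ Δ E} P .(j : B ⊆B A) (σ : Sub B Γ Δ) (τ : Sub A Δ E) →
           (λ {p} (x : Var (P ++ Γ) p) → sub j (liftS P τ) (liftS P σ x))
             ≗S liftS P (λ x → sub j τ (σ x))
  liftSS []      j σ τ x         = refl
  liftSS (a ∷ P) j σ τ here      = refl
  liftSS (a ∷ P) j σ τ (there x) =
    trans (sub-ren j there (liftS (a ∷ P) τ) (liftS P σ x))
   (trans (sym (ren-sub j (liftS P τ) there (liftS P σ x)))
          (cong (ren there) (liftSS P j σ τ x)))

  mutual
    sub-sub : ∀ {C B A Γ Δ E p} .(i : C ⊆B B) .(j : B ⊆B A)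
              (σ : Sub B Γ Δ) (τ : Sub A Δ E) (d : Deriv C Γ p) →
              sub j τ (sub i σ d) ≡ sub (λ m → j (i m)) (λ x → sub j τ (σ x)) d
    sub-sub i j σ τ (ref x)      = refl
    sub-sub i j σ τ (app R m as) = cong (app R (j (i m))) (subA-sub i j σ τ as)

    subA-sub : ∀ {C B A Γ Δ E ps} .(i : C ⊆B B) .(j : B ⊆B A)
               (σ : Sub B Γ Δ) (τ : Sub A Δ E) (as : Args C Γ ps) →
               subA j τ (subA i σ as) ≡ subA (λ m → j (i m)) (λ x → sub j τ (σ x)) as
    subA-sub i j σ τ []             = refl
    subA-sub i j σ τ (_∷_ {P} d ds) =
      cong₂ _∷_ (trans (sub-sub i j (liftS P σ) (liftS P τ) d)
                       (sub-cong (λ m → j (i m)) (liftSS P j σ τ) d))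
                (subA-sub i j σ τ ds)

record World : Set where
  constructor ⟨_,_⟩
  field
    base : Base
    ctx  : Ctx
open World public

data Env (B : Base) (Δ : Ctx) : Ctx → Set where
  []  : Env B Δ []
  _∷_ : ∀ {p Γ} → Deriv B Δ p → Env B Δ Γ → Env B Δ (p ∷ Γ)

lookupE : ∀ {B Δ Γ p} → Env B Δ Γ → Var Γ p → Deriv B Δ p
lookupE (d ∷ e) here      = d
lookupE (d ∷ e) (there x) = lookupE e x

mapE : ∀ {B Δ B' Δ' Γ} → (∀ {p} → Deriv B Δ p → Deriv B' Δ' p) →
       Env B Δ Γ → Env B' Δ' Γ
mapE f []      = []
mapE f (d ∷ e) = f d ∷ mapE f e

record Hom (w v : World) : Set where
  constructor hom
  field
    .incl : base v ⊆B base w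
    env   : Env (base w) (ctx w) (ctx v)
open Hom public using (env)

_∘W_ : ∀ {u v w} → Hom v w → Hom u v → Hom u w
hom j e' ∘W hom i e = hom (λ m → i (j m)) (mapE (sub i (lookupE e)) e')

private
  lookup-map : ∀ {B Δ B' Δ' Γ p} (f : ∀ {q} → Deriv B Δ q → Deriv B' Δ' q)
               (e : Env B Δ Γ) (x : Var Γ p) → lookupE (mapE f e) x ≡ f (lookupE e x)
  lookup-map f (d ∷ e) here      = refl
  lookup-map f (d ∷ e) (there x) = lookup-map f e x

  map-map : ∀ {B Δ B' Δ' B'' Δ'' Γ} (f : ∀ {q} → Deriv B Δ q → Deriv B' Δ' q)
            (g : ∀ {q} → Deriv B' Δ' q → Deriv B'' Δ'' q) (e : Env B Δ Γ) →
            mapE g (mapE f e) ≡ mapE (λ d → g (f d)) e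
  map-map f g []      = refl
  map-map f g (d ∷ e) = cong (g (f d) ∷_) (map-map f g e)

  map-cong : ∀ {B Δ B' Δ' Γ} {f g : ∀ {q} → Deriv B Δ q → Deriv B' Δ' q} →
             (∀ {q} (d : Deriv B Δ q) → f d ≡ g d) → (e : Env B Δ Γ) →
             mapE f e ≡ mapE g e
  map-cong h []      = refl
  map-cong h (d ∷ e) = cong₂ _∷_ (h d) (map-cong h e)

  hom-ext : ∀ {w v} {f g : Hom w v} → env f ≡ env g → f ≡ g
  hom-ext {f = hom _ e} {g = hom _ .e} refl = refl

∘W-assoc : ∀ {t u v w} (h : Hom v w) (g : Hom u v) (f : Hom t u) →
           h ∘W (g ∘W f) ≡ (h ∘W g) ∘W f
∘W-assoc (hom k eh) (hom j eg) (hom i ef) = hom-ext (sym (trans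
  (map-map (sub j (lookupE eg)) (sub i (lookupE ef)) eh)
  (map-cong (λ d → trans (sub-sub j i (lookupE eg) (lookupE ef) d)
                         (sym (sub-cong (λ m → i (j m))
                                (lookup-map (sub i (lookupE ef)) eg) d)))
            eh)))

-- Presheaves on 𝒲 (valued in setoids, so that the exponential can be
-- compared extensionally without function extensionality)

record Psh : Set₁ where
  field
    Ob  : World → Set
    Eq  : ∀ {w} → Ob w → Ob w → Set
    act : ∀ {v w} → Hom v w → Ob w → Ob v
open Psh public

record Nat (F G : Psh) : Set where
  field
    η       : ∀ w → Ob F w → Ob G w
    resp    : ∀ {w} {x y : Ob F w} → Eq F x y → Eq G (η w x) (η w y)
    natural : ∀ {v w} (f : Hom v w) (x : Ob F w) →
              Eq G (η v (act F f x)) (act G f (η w x))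
open Nat public

yo : World → Psh
yo w = record { Ob = λ v → Hom v w ; Eq = _≡_ ; act = λ f g → g ∘W f }

_×P_ : Psh → Psh → Psh
F ×P G = record
  { Ob  = λ w → Ob F w × Ob G w
  ; Eq  = λ x y → Eq F (proj₁ x) (proj₁ y) × Eq G (proj₂ x) (proj₂ y)
  ; act = λ f x → act F f (proj₁ x) , act G f (proj₂ x) }

module _ (F G : Psh) where
  private
    EqSum : ∀ {w} → Ob F w ⊎ Ob G w → Ob F w ⊎ Ob G w → Set
    EqSum (inj₁ x) (inj₁ y) = Eq F x y
    EqSum (inj₁ x) (inj₂ y) = ⊥
    EqSum (inj₂ x) (inj₁ y) = ⊥
    EqSum (inj₂ x) (inj₂ y) = Eq G x y

    actSum : ∀ {v w} → Hom v w → Ob F w ⊎ Ob G w → Ob F v ⊎ Ob G v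
    actSum f (inj₁ x) = inj₁ (act F f x)
    actSum f (inj₂ y) = inj₂ (act G f y)

  _+P_ : Psh
  _+P_ = record { Ob = λ w → Ob F w ⊎ Ob G w ; Eq = EqSum ; act = actSum }

_⊃P_ : Psh → Psh → Psh
F ⊃P G = record
  { Ob  = λ w → Nat (yo w ×P F) G
  ; Eq  = λ {w} β β' → ∀ v (x : Ob (yo w ×P F) v) → Eq G (η β v x) (η β' v x)
  ; act = actExp }
  where
  actExp : ∀ {v w} → Hom v w → Nat (yo w ×P F) G → Nat (yo v ×P F) G
  actExp f β = record
    { η       = λ u x → η β u (f ∘W proj₁ x , proj₂ x)
    ; resp    = λ { (e₁ , e₂) → resp β (cong (f ∘W_) e₁ , e₂) }
    ; natural = λ h x →
        subst (λ k → Eq G (η β _ (k , act F h (proj₂ x)))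
                          (act G h (η β _ (f ∘W proj₁ x , proj₂ x))))
              (sym (∘W-assoc f (proj₁ x) h))
              (natural β h (f ∘W proj₁ x , proj₂ x)) }

infixr 6 _∧_
infixr 5 _∨_
infixr 4 _⊃_

data Formula : Set where
  atom : Atom → Formula
  _∧_  : Formula → Formula → Formula
  _∨_  : Formula → Formula → Formula
  _⊃_  : Formula → Formula → Formula

atomPsh : Atom → Psh
atomPsh p = record
  { Ob  = λ w → Deriv (base w) (ctx w) p
  ; Eq  = _≡_
  ; act = λ { (hom i e) d → sub i (lookupE e) d } }

⟦_⟧ : Formula → Psh
⟦ atom p ⟧ = atomPsh p
⟦ φ ∧ ψ ⟧  = ⟦ φ ⟧ ×P ⟦ ψ ⟧
⟦ φ ∨ ψ ⟧  = ⟦ φ ⟧ +P ⟦ ψ ⟧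
⟦ φ ⊃ ψ ⟧  = ⟦ φ ⟧ ⊃P ⟦ ψ ⟧

-- An element β of ⟦ p ⊃ (q ∨ r) ⟧ at a world w is a natural family, so it
-- can be evaluated at the generic point: the world w ▸ p with one fresh
-- hypothesis x : p, reached from w by weakening. There β yields a
-- derivation of q or of r from the context extended by x, and abstracting
-- x again gives an element of ⟦ p ⊃ q ⟧ or of ⟦ p ⊃ r ⟧ at w, which fixes
-- the disjunct. Naturality in w holds because extending a world by p is
-- functorial and commutes with weakening.

module Submission where

open import Defs
open import Data.List using ([]; _∷_; _++_)
open import Data.Product using (_×_; _,_)
open import Data.Sum using (inj₁; inj₂)
open import Relation.Binary.PropositionalEquality
  using (_≡_; refl; sym; trans; cong; cong₂; subst; module ≡-Reasoning)

-- The congruence and fusion laws of renaming and substitution (their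
-- copies in Defs are private).

_≗R_ : ∀ {Γ Δ} → Ren Γ Δ → Ren Γ Δ → Set
ρ ≗R ρ' = ∀ {p} (x : Var _ p) → ρ x ≡ ρ' x

_≗S_ : ∀ {B Γ Δ} → Sub B Γ Δ → Sub B Γ Δ → Set
σ ≗S σ' = ∀ {p} (x : Var _ p) → σ x ≡ σ' x

liftR-cong : ∀ {Γ Δ} P {ρ ρ' : Ren Γ Δ} → ρ ≗R ρ' → liftR P ρ ≗R liftR P ρ'
liftR-cong []      e x         = e x
liftR-cong (a ∷ P) e here      = refl
liftR-cong (a ∷ P) e (there x) = cong there (liftR-cong P e x)

mutual
  ren-cong : ∀ {B Γ Δ p} {ρ ρ' : Ren Γ Δ} → ρ ≗R ρ' → (d : Deriv B Γ p) →
             ren ρ d ≡ ren ρ' d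
  ren-cong e (ref x)      = cong ref (e x)
  ren-cong e (app R m as) = cong (app R m) (renA-cong e as)

  renA-cong : ∀ {B Γ Δ ps} {ρ ρ' : Ren Γ Δ} → ρ ≗R ρ' → (as : Args B Γ ps) →
              renA ρ as ≡ renA ρ' as
  renA-cong e []             = refl
  renA-cong e (_∷_ {P} d ds) =
    cong₂ _∷_ (ren-cong (liftR-cong P e) d) (renA-cong e ds)

liftS-cong : ∀ {B Γ Δ} P {σ σ' : Sub B Γ Δ} → σ ≗S σ' → liftS P σ ≗S liftS P σ'
liftS-cong []      e x         = e x
liftS-cong (a ∷ P) e here      = refl
liftS-cong (a ∷ P) e (there x) = cong (ren there) (liftS-cong P e x)

mutual
  sub-cong : ∀ {C B Γ Δ p} .(i : C ⊆B B) {σ σ' : Sub B Γ Δ} → σ ≗S σ' →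
             (d : Deriv C Γ p) → sub i σ d ≡ sub i σ' d
  sub-cong i e (ref x)      = e x
  sub-cong i e (app R m as) = cong (app R (i m)) (subA-cong i e as)

  subA-cong : ∀ {C B Γ Δ ps} .(i : C ⊆B B) {σ σ' : Sub B Γ Δ} → σ ≗S σ' →
              (as : Args C Γ ps) → subA i σ as ≡ subA i σ' as
  subA-cong i e []             = refl
  subA-cong i e (_∷_ {P} d ds) =
    cong₂ _∷_ (sub-cong i (liftS-cong P e) d) (subA-cong i e ds)

liftR-comp : ∀ {Γ Δ E} P (ρ₁ : Ren Γ Δ) (ρ₂ : Ren Δ E) →
             (λ {p} (x : Var (P ++ Γ) p) → liftR P ρ₂ (liftR P ρ₁ x))
               ≗R liftR P (λ x → ρ₂ (ρ₁ x))
liftR-comp []      ρ₁ ρ₂ x         = refl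
liftR-comp (a ∷ P) ρ₁ ρ₂ here      = refl
liftR-comp (a ∷ P) ρ₁ ρ₂ (there x) = cong there (liftR-comp P ρ₁ ρ₂ x)

mutual
  ren-ren : ∀ {B Γ Δ E p} (ρ₁ : Ren Γ Δ) (ρ₂ : Ren Δ E) (d : Deriv B Γ p) →
            ren ρ₂ (ren ρ₁ d) ≡ ren (λ x → ρ₂ (ρ₁ x)) d
  ren-ren ρ₁ ρ₂ (ref x)      = refl
  ren-ren ρ₁ ρ₂ (app R m as) = cong (app R m) (renA-ren ρ₁ ρ₂ as)

  renA-ren : ∀ {B Γ Δ E ps} (ρ₁ : Ren Γ Δ) (ρ₂ : Ren Δ E) (as : Args B Γ ps) →
             renA ρ₂ (renA ρ₁ as) ≡ renA (λ x → ρ₂ (ρ₁ x)) as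
  renA-ren ρ₁ ρ₂ []             = refl
  renA-ren ρ₁ ρ₂ (_∷_ {P} d ds) =
    cong₂ _∷_ (trans (ren-ren (liftR P ρ₁) (liftR P ρ₂) d)
                     (ren-cong (liftR-comp P ρ₁ ρ₂) d))
              (renA-ren ρ₁ ρ₂ ds)

liftSR : ∀ {B Γ Δ E} P (ρ : Ren Γ Δ) (σ : Sub B Δ E) →
         (λ {p} (x : Var (P ++ Γ) p) → liftS P σ (liftR P ρ x))
           ≗S liftS P (λ x → σ (ρ x))
liftSR []      ρ σ x         = refl
liftSR (a ∷ P) ρ σ here      = refl
liftSR (a ∷ P) ρ σ (there x) = cong (ren there) (liftSR P ρ σ x)

mutual
  sub-ren : ∀ {C B Γ Δ E p} .(i : C ⊆B B) (ρ : Ren Γ Δ) (σ : Sub B Δ E)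
            (d : Deriv C Γ p) → sub i σ (ren ρ d) ≡ sub i (λ x → σ (ρ x)) d
  sub-ren i ρ σ (ref x)      = refl
  sub-ren i ρ σ (app R m as) = cong (app R (i m)) (subA-ren i ρ σ as)

  subA-ren : ∀ {C B Γ Δ E ps} .(i : C ⊆B B) (ρ : Ren Γ Δ) (σ : Sub B Δ E)
             (as : Args C Γ ps) → subA i σ (renA ρ as) ≡ subA i (λ x → σ (ρ x)) as
  subA-ren i ρ σ []             = refl
  subA-ren i ρ σ (_∷_ {P} d ds) =
    cong₂ _∷_ (trans (sub-ren i (liftR P ρ) (liftS P σ) d)
                     (sub-cong i (liftSR P ρ σ) d))
              (subA-ren i ρ σ ds)

liftRS : ∀ {B Γ Δ E} P (σ : Sub B Γ Δ) (ρ : Ren Δ E) →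
         (λ {p} (x : Var (P ++ Γ) p) → ren (liftR P ρ) (liftS P σ x))
           ≗S liftS P (λ x → ren ρ (σ x))
liftRS []      σ ρ x         = refl
liftRS (a ∷ P) σ ρ here      = refl
liftRS (a ∷ P) σ ρ (there x) =
  trans (ren-ren there (liftR (a ∷ P) ρ) (liftS P σ x))
 (trans (sym (ren-ren (liftR P ρ) there (liftS P σ x)))
        (cong (ren there) (liftRS P σ ρ x)))

mutual
  ren-sub : ∀ {C B Γ Δ E p} .(i : C ⊆B B) (σ : Sub B Γ Δ) (ρ : Ren Δ E)
            (d : Deriv C Γ p) → ren ρ (sub i σ d) ≡ sub i (λ x → ren ρ (σ x)) d
  ren-sub i σ ρ (ref x)      = refl
  ren-sub i σ ρ (app R m as) = cong (app R (i m)) (renA-sub i σ ρ as)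

  renA-sub : ∀ {C B Γ Δ E ps} .(i : C ⊆B B) (σ : Sub B Γ Δ) (ρ : Ren Δ E)
             (as : Args C Γ ps) → renA ρ (subA i σ as) ≡ subA i (λ x → ren ρ (σ x)) as
  renA-sub i σ ρ []             = refl
  renA-sub i σ ρ (_∷_ {P} d ds) =
    cong₂ _∷_ (trans (ren-sub i (liftS P σ) (liftR P ρ) d)
                     (sub-cong i (liftRS P σ ρ) d))
              (renA-sub i σ ρ ds)

liftSS : ∀ {A B Γ Δ E} P .(j : B ⊆B A) (σ : Sub B Γ Δ) (τ : Sub A Δ E) →
         (λ {p} (x : Var (P ++ Γ) p) → sub j (liftS P τ) (liftS P σ x))
           ≗S liftS P (λ x → sub j τ (σ x))
liftSS []      j σ τ x         = refl
liftSS (a ∷ P) j σ τ here      = refl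
liftSS (a ∷ P) j σ τ (there x) =
  trans (sub-ren j there (liftS (a ∷ P) τ) (liftS P σ x))
 (trans (sym (ren-sub j (liftS P τ) there (liftS P σ x)))
        (cong (ren there) (liftSS P j σ τ x)))

mutual
  sub-sub : ∀ {C B A Γ Δ E p} .(i : C ⊆B B) .(j : B ⊆B A)
            (σ : Sub B Γ Δ) (τ : Sub A Δ E) (d : Deriv C Γ p) →
            sub j τ (sub i σ d) ≡ sub (λ m → j (i m)) (λ x → sub j τ (σ x)) d
  sub-sub i j σ τ (ref x)      = refl
  sub-sub i j σ τ (app R m as) = cong (app R (j (i m))) (subA-sub i j σ τ as)

  subA-sub : ∀ {C B A Γ Δ E ps} .(i : C ⊆B B) .(j : B ⊆B A)
             (σ : Sub B Γ Δ) (τ : Sub A Δ E) (as : Args C Γ ps) →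
             subA j τ (subA i σ as) ≡ subA (λ m → j (i m)) (λ x → sub j τ (σ x)) as
  subA-sub i j σ τ []             = refl
  subA-sub i j σ τ (_∷_ {P} d ds) =
    cong₂ _∷_ (trans (sub-sub i j (liftS P σ) (liftS P τ) d)
                     (sub-cong (λ m → j (i m)) (liftSS P j σ τ) d))
              (subA-sub i j σ τ ds)

lookup-mapE : ∀ {B Δ B' Δ' Γ p} (f : ∀ {q} → Deriv B Δ q → Deriv B' Δ' q)
              (e : Env B Δ Γ) (x : Var Γ p) → lookupE (mapE f e) x ≡ f (lookupE e x)
lookup-mapE f (d ∷ e) here      = refl
lookup-mapE f (d ∷ e) (there x) = lookup-mapE f e x

tabulateE : ∀ {B Δ Γ} → Sub B Γ Δ → Env B Δ Γ
tabulateE {Γ = []}    σ = []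
tabulateE {Γ = a ∷ Γ} σ = σ here ∷ tabulateE (λ x → σ (there x))

lookup-tabulateE : ∀ {B Δ Γ p} (σ : Sub B Γ Δ) (x : Var Γ p) →
                   lookupE (tabulateE σ) x ≡ σ x
lookup-tabulateE σ here      = refl
lookup-tabulateE σ (there x) = lookup-tabulateE (λ y → σ (there y)) x

Env-ext : ∀ {B Δ Γ} {e e' : Env B Δ Γ} →
          (∀ {p} (x : Var Γ p) → lookupE e x ≡ lookupE e' x) → e ≡ e'
Env-ext {e = []}    {[]}      h = refl
Env-ext {e = d ∷ e} {d' ∷ e'} h = cong₂ _∷_ (h here) (Env-ext (λ x → h (there x)))

Hom-ext : ∀ {w v} {f g : Hom w v} → env f ≡ env g → f ≡ g
Hom-ext {f = hom _ e} {g = hom _ .e} refl = refl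

liftS-ref : ∀ {B Γ Δ} P (ρ : Ren Γ Δ) {p} (x : Var (P ++ Γ) p) →
            liftS {B} P (λ y → ref (ρ y)) x ≡ ref (liftR P ρ x)
liftS-ref []      ρ x         = refl
liftS-ref (a ∷ P) ρ here      = refl
liftS-ref (a ∷ P) ρ (there x) = cong (ren there) (liftS-ref P ρ x)

mutual
  sub-ref : ∀ {B Γ Δ p} .(i : B ⊆B B) (ρ : Ren Γ Δ) (d : Deriv B Γ p) →
            sub i (λ y → ref (ρ y)) d ≡ ren ρ d
  sub-ref i ρ (ref x)      = refl
  sub-ref i ρ (app R m as) = cong (app R (i m)) (subA-ref i ρ as)

  subA-ref : ∀ {B Γ Δ ps} .(i : B ⊆B B) (ρ : Ren Γ Δ) (as : Args B Γ ps) →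
             subA i (λ y → ref (ρ y)) as ≡ renA ρ as
  subA-ref i ρ []             = refl
  subA-ref i ρ (_∷_ {P} d ds) =
    cong₂ _∷_ (trans (sub-cong i (liftS-ref P ρ) d) (sub-ref i (liftR P ρ) d))
              (subA-ref i ρ ds)

ext : ∀ {B Γ Δ p} → Deriv B Δ p → Sub B Γ Δ → Sub B (p ∷ Γ) Δ
ext a σ here      = a
ext a σ (there x) = σ x

sub-ext-mapE : ∀ {B C Γ Δ E p q} .(j : B ⊆B C) (τ : Sub C Δ E) (a : Deriv B Δ p)
               (e : Env B Δ Γ) (x : Var (p ∷ Γ) q) →
               sub j τ (ext a (lookupE e) x)
                 ≡ ext (sub j τ a) (lookupE (mapE (sub j τ) e)) x
sub-ext-mapE j τ a e here      = refl
sub-ext-mapE j τ a e (there x) = sym (lookup-mapE (sub j τ) e x)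

sub-ext-liftS : ∀ {B C Γ Δ E p q} .(j : B ⊆B C) (τ : Sub C Δ E) (a : Deriv C E p)
                (e : Env B Δ Γ) (x : Var (p ∷ Γ) q) →
                sub j (ext a τ) (liftS (p ∷ []) (lookupE e) x)
                  ≡ ext a (lookupE (mapE (sub j τ) e)) x
sub-ext-liftS j τ a e here      = refl
sub-ext-liftS j τ a e (there x) =
  trans (sub-ren j there (ext a τ) (lookupE e x)) (sym (lookup-mapE (sub j τ) e x))

_▸_ : World → Atom → World
w ▸ p = ⟨ base w , p ∷ ctx w ⟩

weaken : ∀ w p → Hom (w ▸ p) w
weaken w p = hom (λ m → m) (tabulateE (λ x → ref (there x)))

lift : ∀ {v w} p → Hom v w → Hom (v ▸ p) (w ▸ p)
lift p (hom i e) = hom i (tabulateE (liftS (p ∷ []) (lookupE e)))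

weaken-lift : ∀ {v w} p (g : Hom v w) → weaken w p ∘W lift p g ≡ g ∘W weaken v p
weaken-lift {v} {w} p (hom i e) = Hom-ext (Env-ext λ x → begin
  lookupE (mapE (sub i (lookupE liftedE)) (tabulateE (λ y → ref (there y)))) x
    ≡⟨ lookup-mapE _ (tabulateE (λ y → ref (there y))) x ⟩
  sub i (lookupE liftedE) (lookupE (tabulateE (λ y → ref (there y))) x)
    ≡⟨ cong (sub i _) (lookup-tabulateE (λ y → ref (there y)) x) ⟩
  lookupE liftedE (there x)
    ≡⟨ lookup-tabulateE (liftS (p ∷ []) (lookupE e)) (there x) ⟩
  ren there (lookupE e x)
    ≡⟨ sym (sub-ref (λ m → m) there (lookupE e x)) ⟩
  sub (λ m → m) (λ y → ref (there y)) (lookupE e x)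
    ≡⟨ sub-cong (λ m → m) (λ y → sym (lookup-tabulateE (λ z → ref (there z)) y))
                (lookupE e x) ⟩
  sub (λ m → m) (lookupE (tabulateE (λ y → ref (there y)))) (lookupE e x)
    ≡⟨ sym (lookup-mapE _ e x) ⟩
  lookupE (mapE (sub (λ m → m) (lookupE (tabulateE (λ y → ref (there y))))) e) x ∎)
  where
  open ≡-Reasoning
  liftedE : Env (base v) (p ∷ ctx v) (p ∷ ctx w)
  liftedE = tabulateE (liftS (p ∷ []) (lookupE e))

generic : ∀ F {w} p → Ob (atomPsh p ⊃P F) w → Ob F (w ▸ p)
generic F {w} p β = η β (w ▸ p) (weaken w p , ref here)

generic-resp : ∀ F {w} p {β β' : Ob (atomPsh p ⊃P F) w} → Eq (atomPsh p ⊃P F) β β' →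
               Eq F (generic F p β) (generic F p β')
generic-resp F {w} p β≈β' = β≈β' (w ▸ p) (weaken w p , ref here)

generic-natural : ∀ F {v w} p (g : Hom v w) (β : Ob (atomPsh p ⊃P F) w) →
                  Eq F (generic F p (act (atomPsh p ⊃P F) g β))
                       (act F (lift p g) (generic F p β))
generic-natural F {v} {w} p g β =
  subst (λ k → Eq F (η β (v ▸ p) (k , ref here)) (act F (lift p g) (generic F p β)))
        (weaken-lift p g)
        (natural β (lift p g) (weaken w p , ref here))

abstraction : ∀ {w p s} → Deriv (base w) (p ∷ ctx w) s → Ob ⟦ atom p ⊃ atom s ⟧ w
abstraction {w} {p} {s} d = record
  { η       = apply
  ; resp    = λ { (refl , refl) → refl }
  ; natural = apply-natural }
  where
  apply : ∀ u → Hom u w × Deriv (base u) (ctx u) p → Deriv (base u) (ctx u) s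
  apply u (hom i e , a) = sub i (ext a (lookupE e)) d

  apply-natural : ∀ {v u} (h : Hom v u) (x : Hom u w × Deriv (base u) (ctx u) p) →
                  apply v (act (yo w ×P atomPsh p) h x) ≡ act (atomPsh s) h (apply u x)
  apply-natural (hom j τ) (hom i e , a) =
    sym (trans (sub-sub i j (ext a (lookupE e)) (lookupE τ) d)
               (sub-cong _ (sub-ext-mapE j (lookupE τ) a e) d))

abstraction-natural : ∀ {v w p s} (g : Hom v w) (d : Deriv (base w) (p ∷ ctx w) s) →
                      Eq ⟦ atom p ⊃ atom s ⟧
                         (abstraction (act (atomPsh s) (lift p g) d))
                         (act ⟦ atom p ⊃ atom s ⟧ g (abstraction d))
abstraction-natural {p = p} (hom i e) d u (hom j τ , a) =
  trans (sub-sub i j _ (ext a (lookupE τ)) d) (sub-cong _ pointwise d)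
  where
  pointwise : ∀ {t} (x : Var (p ∷ _) t) →
              sub j (ext a (lookupE τ)) (lookupE (tabulateE (liftS (p ∷ []) (lookupE e))) x)
                ≡ ext a (lookupE (mapE (sub j (lookupE τ)) e)) x
  pointwise x = trans (cong (sub j _) (lookup-tabulateE (liftS (p ∷ []) (lookupE e)) x))
                      (sub-ext-liftS j (lookupE τ) a e x)

module Abstraction⊎ (p q r : Atom) where

  S T : Psh
  S = ⟦ atom q ∨ atom r ⟧
  T = ⟦ (atom p ⊃ atom q) ∨ (atom p ⊃ atom r) ⟧

  abstraction⊎ : ∀ {w} → Ob S (w ▸ p) → Ob T w
  abstraction⊎ (inj₁ d) = inj₁ (abstraction d)
  abstraction⊎ (inj₂ d) = inj₂ (abstraction d)

  abstraction⊎-resp : ∀ {w} (s s' : Ob S (w ▸ p)) → Eq S s s' →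
                      Eq T (abstraction⊎ s) (abstraction⊎ s')
  abstraction⊎-resp (inj₁ d) (inj₁ .d) refl _ _ = refl
  abstraction⊎-resp (inj₂ d) (inj₂ .d) refl _ _ = refl

  abstraction⊎-natural : ∀ {v w} (g : Hom v w) (s : Ob S (v ▸ p)) (s' : Ob S (w ▸ p)) →
                         Eq S s (act S (lift p g) s') →
                         Eq T (abstraction⊎ s) (act T g (abstraction⊎ s'))
  abstraction⊎-natural g (inj₁ _) (inj₁ d) refl = abstraction-natural g d
  abstraction⊎-natural g (inj₂ _) (inj₂ d) refl = abstraction-natural g d

theorem20 : (p q r : Atom) →
    Nat ⟦ atom p ⊃ (atom q ∨ atom r) ⟧ ⟦ (atom p ⊃ atom q) ∨ (atom p ⊃ atom r) ⟧
theorem20 p q r = record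
  { η       = λ w β → abstraction⊎ (generic S p β)
  ; resp    = λ {_} {β} {β'} β≈β' →
      abstraction⊎-resp (generic S p β) (generic S p β') (generic-resp S p {β = β} {β'} β≈β')
  ; natural = λ g β →
      abstraction⊎-natural g (generic S p (act ⟦ atom p ⊃ (atom q ∨ atom r) ⟧ g β))
        (generic S p β) (generic-natural S p g β) }
  where open Abstraction⊎ p q r
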